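{- Let $n\ge 2$, let $0\le \alpha_1<\alpha_2<\dots<\alpha_n$ be integers, and let $x_1,\dots,x_n$ be positive integers. For $0\le k\le n$ put $p_k=\sum_{i=1}^k x_i$ and $q_k=\sum_{i=1}^k \alpha_i x_i$ (so $p_0=q_0=0$). Suppose that for every $k$ with $1\le k\le n$, $$q_{k-1}-\frac{p_{k-1}(p_{k-1}-1)}{2}\ge 0\quad\text{and}\quad 1\le x_k\le \frac{\bigl(2(\alpha_k-p_{k-1})+1\bigr)+\sqrt{\bigl(2(\alpha_k-p_{k-1})+1\bigr)^2+8\bigl(q_{k-1}-p_{k-1}(p_{k-1}-1)/2\bigr)}}{2},$$ with equality in the right-hand inequality when $k=n$. Then there exists a nonnegative integer $f$ with $f\le (2\alpha_n+1)/2$ such that $$(2\alpha_n+1-2f)\,f=\sum_{i=1}^{n-1}(\alpha_n-\alpha_i)\,x_i .$$ -}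

module Defs where

open import Data.Nat as ℕ using (ℕ; zero; suc)
open import Data.Integer as ℤ using (ℤ; +_; _+_; _*_; _-_; _≤_)
open import Data.Sum using (_⊎_)
open import Data.Product using (_×_)
open import Relation.Binary.PropositionalEquality using (_≡_)

-- Sequences are indexed by ℕ; only indices 1..n matter.
-- psum f k = f 1 + ... + f k   (psum f 0 = 0)
psum : (ℕ → ℤ) → ℕ → ℤ
psum f zero    = + 0
psum f (suc k) = psum f k + f (suc k)

pp : (ℕ → ℕ) → ℕ → ℤ
pp x = psum (λ i → + x i)

qq : (ℕ → ℕ) → (ℕ → ℕ) → ℕ → ℤ
qq α x = psum (λ i → + α i * + x i)

-- "t ≤ √D" for integers t and D ≥ 0 (real square root):
-- holds iff t ≤ 0 or t² ≤ D.
LeSqrt : ℤ → ℤ → Set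
LeSqrt t D = (t ≤ + 0) ⊎ (t * t ≤ D)

-- "t = √D" for integers t and D ≥ 0: t ≥ 0 and t² = D.
EqSqrt : ℤ → ℤ → Set
EqSqrt t D = (+ 0 ≤ t) × (t * t ≡ D)

-- b_k = 2(α_k − p_{k−1}) + 1, stated for k = suc j (so p_{k−1} = pp x j)
bb : (ℕ → ℕ) → (ℕ → ℕ) → ℕ → ℤ
bb α x j = + 2 * (+ α (suc j) - pp x j) + + 1

-- 2 c_{k−1} = 2 q_{k−1} − p_{k−1}(p_{k−1} − 1)   (an integer)
twoC : (ℕ → ℕ) → (ℕ → ℕ) → ℕ → ℤ
twoC α x j = + 2 * qq α x j - pp x j * (pp x j - + 1)

-- discriminant  b_k² + 8 c_{k−1} = b_k² + 4·(2 c_{k−1})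
disc : (ℕ → ℕ) → (ℕ → ℕ) → ℕ → ℤ
disc α x j = bb α x j * bb α x j + + 4 * twoC α x j

-- Hypothesis for k = suc j:
--   c_{k−1} ≥ 0,  1 ≤ x_k,  x_k ≤ (b_k + √disc)/2  i.e.  2x_k − b_k ≤ √disc
Cond : (ℕ → ℕ) → (ℕ → ℕ) → ℕ → Set
Cond α x j =
  (+ 0 ≤ twoC α x j) × (1 ℕ.≤ x (suc j)) ×
  LeSqrt (+ 2 * + x (suc j) - bb α x j) (disc α x j)

-- Equality case: x_k = (b_k + √disc)/2  i.e.  2x_k − b_k = √disc
EqCond : (ℕ → ℕ) → (ℕ → ℕ) → ℕ → Set
EqCond α x j = EqSqrt (+ 2 * + x (suc j) - bb α x j) (disc α x j)

rhsSum : (ℕ → ℕ) → (ℕ → ℕ) → ℕ → ℕ → ℤ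
rhsSum α x n m = psum (λ i → (+ α n - + α i) * + x i) m

{-# OPTIONS --safe #-}
-- Write y = x_n, b = b_n and c = c_{n−1}. The equality case 2y − b = √(b² + 8c) makes y a root
-- of y² − b y − 2c, and substituting b and c turns this into
--   (2α_n + 1 − p_n) p_n = 2 (α_n p_{n−1} − q_{n−1}) = 2 Σ_{i<n} (α_n − α_i) x_i = 2R.
-- The two roots p_n and 2α_n + 1 − p_n of X (2α_n + 1 − X) = 2R have opposite parities, so one of
-- them is 2f; halving gives the claim, and R ≥ 0 (the α_i increase) forces 2f ≤ 2α_n + 1.
-- Only the equality case k = n of the hypotheses is needed.
module Submission where

open import Defs
open import Data.Nat as ℕ using (ℕ; zero; suc; _∸_)
open import Data.Integer as ℤ using (ℤ; +_; _*_; _-_)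
open import Data.Product using (_×_; ∃-syntax; _,_; proj₂)
open import Data.Sum using (_⊎_; inj₁; inj₂)
open import Relation.Binary.PropositionalEquality
import Data.Nat.Properties as ℕₚ
import Data.Integer.Properties as ℤₚ
open import Data.Integer.Tactic.RingSolver using (solve-∀)
open import Algebra.Properties.CommutativeSemigroup ℤₚ.*-commutativeSemigroup using (x∙yz≈y∙xz)
open ≡-Reasoning

psum-nonneg : ∀ (f : ℕ → ℤ) k → (∀ i → 1 ℕ.≤ i → i ℕ.≤ k → + 0 ℤ.≤ f i) → + 0 ℤ.≤ psum f k
psum-nonneg f zero    f≥0 = ℤ.+≤+ ℕ.z≤n
psum-nonneg f (suc k) f≥0 =
  ℤₚ.+-mono-≤ (psum-nonneg f k (λ i 1≤i i≤k → f≥0 i 1≤i (ℕₚ.m≤n⇒m≤1+n i≤k)))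
              (f≥0 (suc k) (ℕ.s≤s ℕ.z≤n) ℕₚ.≤-refl)

pp-nonneg : ∀ x k → + 0 ℤ.≤ pp x k
pp-nonneg x k = psum-nonneg _ k (λ _ _ _ → ℤ.+≤+ ℕ.z≤n)

rhsSum-nonneg : ∀ α x n k → (∀ i → 1 ℕ.≤ i → i ℕ.≤ k → α i ℕ.≤ α n) → + 0 ℤ.≤ rhsSum α x n k
rhsSum-nonneg α x n k αᵢ≤αₙ = psum-nonneg _ k λ i 1≤i i≤k →
  ℤₚ.*-monoʳ-≤-nonNeg (+ x i) (ℤₚ.i≤j⇒0≤j-i (ℤ.+≤+ (αᵢ≤αₙ i 1≤i i≤k)))

rhsSum≡αₙpₖ-qₖ : ∀ α x n k → rhsSum α x n k ≡ + α n * pp x k - qq α x k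
rhsSum≡αₙpₖ-qₖ α x n zero    = sym (trans (ℤₚ.+-identityʳ _) (ℤₚ.*-zeroʳ (+ α n)))
rhsSum≡αₙpₖ-qₖ α x n (suc k) = begin
  rhsSum α x n k ℤ.+ (+ α n - + α (suc k)) * + x (suc k)
    ≡⟨ cong (ℤ._+ (+ α n - + α (suc k)) * + x (suc k)) (rhsSum≡αₙpₖ-qₖ α x n k) ⟩
  (+ α n * pp x k - qq α x k) ℤ.+ (+ α n - + α (suc k)) * + x (suc k)
    ≡⟨ step (+ α n) (+ α (suc k)) (pp x k) (qq α x k) (+ x (suc k)) ⟩
  + α n * pp x (suc k) - qq α x (suc k) ∎
  where
  step : ∀ A a P Q y → (A * P - Q) ℤ.+ (A - a) * y ≡ A * (P ℤ.+ y) - (Q ℤ.+ a * y)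
  step = solve-∀

root-of-disc : ∀ (y B C : ℤ) → (+ 2 * y - B) * (+ 2 * y - B) ≡ B * B ℤ.+ + 4 * C →
  y * y ≡ y * B ℤ.+ C
root-of-disc y B C sq = ℤₚ.*-cancelˡ-≡ (+ 4) _ _ (begin
  + 4 * (y * y)                                            ≡⟨ expand y B ⟩
  (+ 2 * y - B) * (+ 2 * y - B) ℤ.+ (+ 4 * (y * B) - B * B) ≡⟨ cong (ℤ._+ (+ 4 * (y * B) - B * B)) sq ⟩
  B * B ℤ.+ + 4 * C ℤ.+ (+ 4 * (y * B) - B * B)             ≡⟨ collect y B C ⟩
  + 4 * (y * B ℤ.+ C)                                      ∎)
  where
  expand : ∀ y B → + 4 * (y * y) ≡ (+ 2 * y - B) * (+ 2 * y - B) ℤ.+ (+ 4 * (y * B) - B * B)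
  expand = solve-∀
  collect : ∀ y B C → B * B ℤ.+ + 4 * C ℤ.+ (+ 4 * (y * B) - B * B) ≡ + 4 * (y * B ℤ.+ C)
  collect = solve-∀

root⇒pₙ-identity : ∀ (A P Q y : ℤ) →
  y * y ≡ y * (+ 2 * (A - P) ℤ.+ + 1) ℤ.+ (+ 2 * Q - P * (P - + 1)) →
  (+ 2 * A ℤ.+ + 1 - (P ℤ.+ y)) * (P ℤ.+ y) ≡ + 2 * (A * P - Q)
root⇒pₙ-identity A P Q y root = begin
  (+ 2 * A ℤ.+ + 1 - (P ℤ.+ y)) * (P ℤ.+ y)       ≡⟨ expand A P Q y ⟩
  + 2 * (A * P - Q) ℤ.+ (by+c - y * y)            ≡⟨ cong (λ t → + 2 * (A * P - Q) ℤ.+ (by+c - t)) root ⟩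
  + 2 * (A * P - Q) ℤ.+ (by+c - by+c)             ≡⟨ cancel (+ 2 * (A * P - Q)) by+c ⟩
  + 2 * (A * P - Q)                               ∎
  where
  by+c : ℤ
  by+c = y * (+ 2 * (A - P) ℤ.+ + 1) ℤ.+ (+ 2 * Q - P * (P - + 1))
  expand : ∀ A P Q y → (+ 2 * A ℤ.+ + 1 - (P ℤ.+ y)) * (P ℤ.+ y) ≡
    + 2 * (A * P - Q) ℤ.+ (y * (+ 2 * (A - P) ℤ.+ + 1) ℤ.+ (+ 2 * Q - P * (P - + 1)) - y * y)
  expand = solve-∀
  cancel : ∀ u v → u ℤ.+ (v - v) ≡ u
  cancel = solve-∀

nonneg-product⇒≤ : ∀ {N s} → + 0 ℤ.≤ (+ N - + s) * + s → s ℕ.≤ N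
nonneg-product⇒≤ {s = zero}  _         = ℕ.z≤n
nonneg-product⇒≤ {N} {suc s} 0≤[N-s]s =
  ℤₚ.drop‿+≤+ (ℤₚ.0≤i-j⇒j≤i (ℤₚ.*-cancelʳ-≤-pos (+ 0) (+ N - + suc s) (+ suc s) 0≤[N-s]s))

root⇒≤ : ∀ {N s R} → + 0 ℤ.≤ R → (+ N - + s) * + s ≡ + 2 * R → s ℕ.≤ N
root⇒≤ R≥0 root = nonneg-product⇒≤ (subst (+ 0 ℤ.≤_) (sym root) (ℤₚ.*-monoˡ-≤-nonNeg (+ 2) R≥0))

halve-even-root : ∀ N f R → + 0 ℤ.≤ R → (+ N - + (2 ℕ.* f)) * + (2 ℕ.* f) ≡ + 2 * R →
  (2 ℕ.* f ℕ.≤ N) × ((+ N - + (2 ℕ.* f)) * + f ≡ R)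
halve-even-root N f R R≥0 root =
  root⇒≤ R≥0 root ,
  ℤₚ.*-cancelˡ-≡ (+ 2) _ _ (begin
    + 2 * (D * + f)    ≡⟨ x∙yz≈y∙xz (+ 2) D (+ f) ⟩
    D * (+ 2 * + f)    ≡⟨ cong (D *_) (ℤₚ.pos-* 2 f) ⟨
    D * + (2 ℕ.* f)    ≡⟨ root ⟩
    + 2 * R            ∎)
  where
  D : ℤ
  D = + N - + (2 ℕ.* f)

reflect-root : ∀ {N s} → s ℕ.≤ N → (+ N - + (N ∸ s)) * + (N ∸ s) ≡ (+ N - + s) * + s
reflect-root {N} {s} s≤N = begin
  (+ N - + (N ∸ s)) * + (N ∸ s)   ≡⟨ cong (λ t → (+ N - t) * t) N∸s≡N-s ⟩
  (+ N - (+ N - + s)) * (+ N - + s) ≡⟨ swap (+ N) (+ s) ⟩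
  (+ N - + s) * + s               ∎
  where
  N∸s≡N-s : + (N ∸ s) ≡ + N - + s
  N∸s≡N-s = sym (trans (ℤₚ.m-n≡m⊖n N s) (ℤₚ.⊖-≥ s≤N))
  swap : ∀ N s → (N - (N - s)) * (N - s) ≡ (N - s) * s
  swap = solve-∀

even-or-odd : ∀ s → ∃[ h ] (s ≡ 2 ℕ.* h ⊎ s ≡ suc (2 ℕ.* h))
even-or-odd zero          = 0 , inj₁ refl
even-or-odd (suc zero)    = 0 , inj₂ refl
even-or-odd (suc (suc s)) with even-or-odd s
... | h , inj₁ refl = suc h , inj₁ (sym (ℕₚ.*-suc 2 h))
... | h , inj₂ refl = suc h , inj₂ (cong suc (sym (ℕₚ.*-suc 2 h)))

even-root : ∀ A s R → + 0 ℤ.≤ R → (+ (2 ℕ.* A ℕ.+ 1) - + s) * + s ≡ + 2 * R →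
  ∃[ f ] ((2 ℕ.* f ℕ.≤ 2 ℕ.* A ℕ.+ 1) × ((+ (2 ℕ.* A ℕ.+ 1) - + (2 ℕ.* f)) * + f ≡ R))
even-root A s R R≥0 root with even-or-odd s
... | f , inj₁ refl = f , halve-even-root (2 ℕ.* A ℕ.+ 1) f R R≥0 root
... | g , inj₂ refl = A ∸ g , halve-even-root N (A ∸ g) R R≥0 (begin
  (+ N - + (2 ℕ.* (A ∸ g))) * + (2 ℕ.* (A ∸ g)) ≡⟨ cong (λ t → (+ N - + t) * + t) complement ⟩
  (+ N - + (N ∸ 2g+1)) * + (N ∸ 2g+1)           ≡⟨ reflect-root 2g+1≤N ⟩
  (+ N - + 2g+1) * + 2g+1                       ≡⟨ root ⟩
  + 2 * R                                       ∎)
  where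
  N 2g+1 : ℕ
  N = 2 ℕ.* A ℕ.+ 1
  2g+1 = suc (2 ℕ.* g)
  2g+1≤N : 2g+1 ℕ.≤ N
  2g+1≤N = root⇒≤ R≥0 root
  complement : 2 ℕ.* (A ∸ g) ≡ N ∸ 2g+1
  complement = begin
    2 ℕ.* (A ∸ g)            ≡⟨ ℕₚ.*-distribˡ-∸ 2 A g ⟩
    suc (2 ℕ.* A) ∸ 2g+1     ≡⟨ cong (_∸ 2g+1) (ℕₚ.+-comm 1 (2 ℕ.* A)) ⟩
    N ∸ 2g+1                 ∎

theorem2p4 : (n : ℕ) → 2 ℕ.≤ n → (α x : ℕ → ℕ) →
    (∀ i j → 1 ℕ.≤ i → i ℕ.< j → j ℕ.≤ n → α i ℕ.< α j) →
    (∀ i → 1 ℕ.≤ i → i ℕ.≤ n → 1 ℕ.≤ x i) →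
    (∀ j → j ℕ.< n → Cond α x j) →
    (∀ j → suc j ≡ n → EqCond α x j) →
    ∃[ f ] ((2 ℕ.* f ℕ.≤ 2 ℕ.* α n ℕ.+ 1) ×
    ((+ (2 ℕ.* α n ℕ.+ 1) - + (2 ℕ.* f)) * + f ≡ rhsSum α x n (n ∸ 1)))
theorem2p4 (suc m) _ α x increasing _ _ tight =
  even-root A ℤ.∣ pₙ ∣ R (rhsSum-nonneg α x n m αᵢ≤αₙ) (begin
    (+ (2 ℕ.* A ℕ.+ 1) - + ℤ.∣ pₙ ∣) * + ℤ.∣ pₙ ∣
      ≡⟨ cong₂ (λ N p → (N - p) * p) [2A+1]-as-ℤ (ℤₚ.0≤i⇒+∣i∣≡i (pp-nonneg x n)) ⟩
    (+ 2 * + A ℤ.+ + 1 - pₙ) * pₙ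
      ≡⟨ root⇒pₙ-identity (+ A) (pp x m) (qq α x m) (+ x n) xₙ-root ⟩
    + 2 * (+ A * pp x m - qq α x m)
      ≡⟨ cong (+ 2 *_) (rhsSum≡αₙpₖ-qₖ α x n m) ⟨
    + 2 * R ∎)
  where
  n A : ℕ
  n = suc m
  A = α n
  pₙ R : ℤ
  pₙ = pp x n
  R = rhsSum α x n m
  αᵢ≤αₙ : ∀ i → 1 ℕ.≤ i → i ℕ.≤ m → α i ℕ.≤ A
  αᵢ≤αₙ i 1≤i i≤m = ℕₚ.<⇒≤ (increasing i n 1≤i (ℕ.s≤s i≤m) ℕₚ.≤-refl)
  [2A+1]-as-ℤ : + (2 ℕ.* A ℕ.+ 1) ≡ + 2 * + A ℤ.+ + 1
  [2A+1]-as-ℤ = trans (ℤₚ.pos-+ (2 ℕ.* A) 1) (cong (ℤ._+ + 1) (ℤₚ.pos-* 2 A))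
  xₙ-root : + x n * + x n ≡ + x n * bb α x m ℤ.+ twoC α x m
  xₙ-root = root-of-disc (+ x n) (bb α x m) (twoC α x m) (proj₂ (tight m refl))
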